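{- Let $D$ be a multi-set of integers from $[1,w]$ and let $t$ be a positive integer. If $D$ is dense with respect to $t$, then $D$ has a sub-multiset $P$ such that (i) $\mathcal{S}(P)$ contains an arithmetic progression $(a_1,\dots,a_k)$ with $k\ge 5\sqrt{wt}\log w$ and $a_k\le t/2$; and (ii) $\sigma(D)-\sigma(P)\ge t$.
   Context: For a multi-set $Z$, $\sigma(Z)=\sum_{z\in Z} z$, $\mathcal{S}(Z)=\{\sigma(Y):Y\subseteq Z\}$, $\max(\emptyset)=0$. The diameter of a finite set $Z$ is $\max(Z)-\min(Z)+1$. Logarithms are base 2. $C_{ap}$ denotes a fixed absolute constant with the following property: whenever $A_1,\dots,A_\ell$ are non-empty sets of integers of maximum diameter $u$, $f:\{A_i\}\to\mathbb{N}$ is a weight function, and $\sum_i|A_i|\ge \ell+4C_{ap}\rho u'\log u'$ for some $u'\ge u$ and $\rho\ge1$, there is $I\subseteq[1,\ell]$ such that $\sum_{i\in I}A_i$ contains an arithmetic progression of length at least $u'$ and $\sum_{i\in I}f(A_i)\le\frac1\rho\sum_{i=1}^\ell f(A_i)$ (such a constant exists). Definition: $D$ is dense with respect to $t$ if there exist a positive integer $\rho$, a partition $D_1,\dots,D_\ell$ of $D$, a set $S_i\subseteq\mathcal{S}(D_i)$ for each $i$, and a weight function $f:\{S_i\}_{i=1}^{\ell}\to\mathbb{N}$ such that (i) $\sum_{i=1}^{\ell}|S_i|\ge \ell+4C_{ap}\rho u'\log u'$ for some $u'\ge\max\{u,5\sqrt{wt}\log w\}$, where $u$ is the maximum diameter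 of the sets $S_i$; (ii) $\max(S_i)\le f(S_i)\le\sigma(D_i)$ for all $i$; (iii) $\frac{3t}{2}\le\sum_{i=1}^{\ell}f(S_i)\le\frac{\rho t}{2}$. -}

module Defs where

open import Data.Nat using (ℕ; zero; suc; _+_; _*_; _∸_; _^_; _≤_; _<_; _⊔_; _⊓_)
open import Data.Integer as ℤ using (ℤ; +_; ∣_∣)
open import Data.Bool using (Bool; true; false; if_then_else_)
open import Data.Fin using (Fin)
open import Data.Fin.Subset as Sub using (Subset)
open import Data.Vec using (lookup)
open import Data.Nat.ListAction using (sum)
open import Data.List using (List; []; _∷_; foldr; tabulate; concat; length)
open import Data.List.Membership.Propositional as M using ()
open import Data.List.Relation.Unary.All using (All)
open import Data.List.Relation.Unary.Unique.Propositional using (Unique)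
open import Data.List.Relation.Binary.Sublist.Propositional using (_⊆_)
open import Data.List.Relation.Binary.Permutation.Propositional using (_↭_)
open import Data.Product using (Σ; ∃; _×_; _,_)
open import Relation.Binary.PropositionalEquality using (_≡_; _≢_)

sumF : ∀ {ℓ} → (Fin ℓ → ℕ) → ℕ
sumF g = sum (tabulate g)

maxF : ∀ {ℓ} → (Fin ℓ → ℕ) → ℕ
maxF g = foldr _⊔_ 0 (tabulate g)

sumSubℕ : ∀ {ℓ} → Subset ℓ → (Fin ℓ → ℕ) → ℕ
sumSubℕ I g = sum (tabulate (λ i → if lookup I i then g i else 0))

sumSubℤ : ∀ {ℓ} → Subset ℓ → (Fin ℓ → ℤ) → ℤ
sumSubℤ I g = foldr ℤ._+_ (+ 0) (tabulate (λ i → if lookup I i then g i else + 0))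

-- max / min / diameter of finite sets (represented as duplicate-free lists)

-- max with the convention max(∅) = 0
maxℕ : List ℕ → ℕ
maxℕ = foldr _⊔_ 0

diamℕ : List ℕ → ℕ
diamℕ [] = 0
diamℕ (x ∷ xs) = (foldr _⊔_ x xs ∸ foldr _⊓_ x xs) + 1

diamℤ : List ℤ → ℕ
diamℤ [] = 0
diamℤ (x ∷ xs) = ∣ foldr ℤ._⊔_ x xs ℤ.- foldr ℤ._⊓_ x xs ∣ + 1

-- Subset sums  𝒮(Z) = { σ(Y) : Y ⊆ Z }  (Y a sub-multiset of Z)

SubsetSum : List ℕ → ℕ → Set
SubsetSum Z x = Σ (List ℕ) λ Y → (Y ⊆ Z) × (sum Y ≡ x)

InSumset : ∀ {ℓ} → (Fin ℓ → List ℤ) → Subset ℓ → ℤ → Set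
InSumset {ℓ} A I x =
  Σ (Fin ℓ → ℤ) λ c → (∀ i → i Sub.∈ I → c i M.∈ A i) × (x ≡ sumSubℤ I c)

-- Real-valued bounds, encoded exactly with natural numbers
-- (all logs base 2; requires w ≥ 1, t ≥ 1, q ≥ 1).

-- KBound w t p q  ⟺  5·√(w t)·log₂ w ≤ p / q.
-- Writing L = log₂ w ≥ 0 and x = p/(5q√(wt)) ≥ 0 we have L ≤ x iff
-- for every rational a/b with (a/b)² ≥ x² one has L ≤ a/b, i.e. w^b ≤ 2^a.
KBound : ℕ → ℕ → ℕ → ℕ → Set
KBound w t p q =
  ∀ a b → 1 ≤ b → p * p * (b * b) ≤ 25 * w * t * (q * q) * (a * a) → w ^ b ≤ 2 ^ a

-- XLogBound m p q s ℓ  ⟺  s ≥ ℓ + m · (p/q) · log₂ (p/q)   (for p, q ≥ 1)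
-- Multiplying by q and exponentiating: p^(m p) · 2^(q ℓ) ≤ 2^(q s) · q^(m p).
XLogBound : ℕ → ℕ → ℕ → ℕ → ℕ → Set
XLogBound m p q s ℓ = p ^ (m * p) * 2 ^ (q * ℓ) ≤ 2 ^ (q * s) * q ^ (m * p)

-- The defining property of the constant C_ap (for a natural candidate C),
-- with u' = p/q a positive rational and ρ a positive integer.

APProperty : ℕ → Set
APProperty C =
  ∀ (ℓ : ℕ) (A : Fin ℓ → List ℤ) (f : Fin ℓ → ℕ) (u p q ρ : ℕ) →
  (∀ i → A i ≢ []) → (∀ i → Unique (A i)) → (∀ i → diamℤ (A i) ≤ u) →
  1 ≤ p → 1 ≤ q → u * q ≤ p → 1 ≤ ρ →
  XLogBound (4 * C * ρ) p q (sumF (λ i → length (A i))) ℓ →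
  Σ (Subset ℓ) λ I → Σ ℤ λ a → Σ ℕ λ d → Σ ℕ λ k →
    (1 ≤ d) × (p ≤ k * q) ×
    (∀ j → j < k → InSumset A I (a ℤ.+ (+ (j * d)))) ×
    (ρ * sumSubℕ I f ≤ sumF f)

-- D is dense with respect to t  (D a multiset given as a list)

Dense : ℕ → ℕ → ℕ → List ℕ → Set
Dense C w t D =
  Σ ℕ λ ℓ → Σ ℕ λ ρ → (1 ≤ ρ) ×
  Σ (Fin ℓ → List ℕ) λ Ds →
    (∀ i → Ds i ≢ []) × (concat (tabulate Ds) ↭ D) ×
  Σ (Fin ℓ → List ℕ) λ S →
    (∀ i → Unique (S i)) × (∀ i → All (SubsetSum (Ds i)) (S i)) ×
  Σ (Fin ℓ → ℕ) λ f →
    (∀ i → (maxℕ (S i) ≤ f i) × (f i ≤ sum (Ds i))) ×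
    (3 * t ≤ 2 * sumF f) × (2 * sumF f ≤ ρ * t) ×
    -- (i)  some u' = p/q ≥ max{u, 5√(wt) log w} with Σ|S_i| ≥ ℓ + 4 C ρ u' log u'
    Σ ℕ λ p → Σ ℕ λ q → (1 ≤ p) × (1 ≤ q) ×
      (maxF (λ i → diamℕ (S i)) * q ≤ p) × KBound w t p q ×
      XLogBound (4 * C * ρ) p q (sumF (λ i → length (S i))) ℓ

{-# OPTIONS --safe #-}
module Submission where

-- Apply the defining property of C_ap to the sets S_i (as integer sets, an empty S_i padded to {0}).
-- It gives indices I such that Σ_{i∈I} S_i contains a progression of length at least
-- u′ ≥ 5√(wt) log w, while Σ_{i∈I} f(S_i) ≤ (1/ρ) Σ_i f(S_i) ≤ t/2. An element of S_i is a subset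
-- sum of D_i of size at most f(S_i), so the progression lies in 𝒮(P) for P = ⋃_{i∈I} D_i with all
-- terms at most t/2, and σ(D) − σ(P) ≥ Σ_{i∉I} f(S_i) ≥ 3t/2 − t/2 = t. If u′ < 1 the bound
-- 5√(wt) log w < 1 forces w = 1, and the one-term progression 0 in 𝒮(∅) already suffices.

open import Defs
open import Data.Nat using (ℕ; _+_; _*_; _∸_; _≤_; _<_)
open import Data.List using (List)
open import Data.Nat.ListAction using (sum)
open import Data.List.Relation.Unary.All using (All)
open import Data.List.Relation.Binary.Sublist.Propositional using (_⊆_)
open import Data.Product using (Σ; _×_)

open import Data.Nat using (zero; suc; z≤n; s≤s; _⊔_; _⊓_; _^_; _≤?_; NonZero; >-nonZero; >-nonZero⁻¹)
open import Data.Nat.Properties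
open import Data.Nat.ListAction.Properties using (sum-++; sum-↭)
open import Data.Nat.Tactic.RingSolver using (solve-∀)
open import Data.Integer as ℤ using (ℤ; +_; ∣_∣; _⊖_)
import Data.Integer.Properties as ℤₚ
open import Data.Bool using (true; false)
open import Data.Fin using (Fin; zero; suc)
open import Data.Fin.Subset using (Subset; ⊥; ∁) renaming (_∈_ to _∈ₛ_)
open import Data.Vec using ([]; _∷_; here; there)
open import Data.List using ([]; _∷_; _++_; map; foldr; concat; tabulate; length)
import Data.List.Properties as List
open import Data.List.Membership.Propositional using (_∈_)
open import Data.List.Relation.Unary.Any using (here; there)
open import Data.List.Relation.Unary.All as All using ([]; _∷_)
import Data.List.Relation.Unary.All.Properties as All
open import Data.List.Relation.Unary.AllPairs using ([]; _∷_)
open import Data.List.Relation.Unary.Unique.Propositional using (Unique)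
import Data.List.Relation.Unary.Unique.Propositional.Properties as Unique
open import Data.List.Relation.Binary.Sublist.Propositional using ([]; _∷_; _∷ʳ_; minimum; ⊆-refl)
import Data.List.Relation.Binary.Sublist.Propositional.Properties as Sublist
open import Data.List.Relation.Binary.Permutation.Propositional
  using (_↭_; refl; prep; swap; trans; ↭-sym; ↭-trans)
import Data.List.Relation.Binary.Permutation.Propositional.Properties as Perm
open import Data.Product using (∃; _,_; proj₁; proj₂)
open import Function using (_∘_)
open import Relation.Binary.PropositionalEquality using (_≡_; _≢_; refl; sym; cong; cong₂; subst; module ≡-Reasoning)
  renaming (trans to ≡-trans)
open import Relation.Nullary using (yes; no; contradiction)
open import Algebra.Properties.CommutativeSemigroup +-commutativeSemigroup
  using () renaming (x∙yz≈y∙xz to +-left-comm)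
open import Algebra.Properties.CommutativeSemigroup *-commutativeSemigroup
  using () renaming (x∙yz≈y∙xz to *-left-comm)

foldr-map-homo : ∀ {a b} {A : Set a} {B : Set b} (h : A → B) {f : A → A → A} {g : B → B → B} →
                 (∀ x y → h (f x y) ≡ g (h x) (h y)) →
                 ∀ e xs → foldr g (h e) (map h xs) ≡ h (foldr f e xs)
foldr-map-homo h hom e [] = refl
foldr-map-homo h {g = g} hom e (x ∷ xs) =
  ≡-trans (cong (g (h x)) (foldr-map-homo h hom e xs)) (sym (hom x _))

⊆-↭⇒↭-⊆ : ∀ {a} {A : Set a} {xs ys zs : List A} → xs ⊆ ys → ys ↭ zs →
           ∃ λ xs′ → xs ↭ xs′ × xs′ ⊆ zs
⊆-↭⇒↭-⊆ s refl = _ , refl , s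
⊆-↭⇒↭-⊆ (_ ∷ʳ s) (prep x p) with ⊆-↭⇒↭-⊆ s p
... | xs′ , q , s′ = xs′ , q , x ∷ʳ s′
⊆-↭⇒↭-⊆ (refl ∷ s) (prep x p) with ⊆-↭⇒↭-⊆ s p
... | xs′ , q , s′ = x ∷ xs′ , prep x q , refl ∷ s′
⊆-↭⇒↭-⊆ (_ ∷ʳ (_ ∷ʳ s)) (swap x y p) with ⊆-↭⇒↭-⊆ s p
... | xs′ , q , s′ = xs′ , q , y ∷ʳ (x ∷ʳ s′)
⊆-↭⇒↭-⊆ (_ ∷ʳ (refl ∷ s)) (swap x y p) with ⊆-↭⇒↭-⊆ s p
... | xs′ , q , s′ = y ∷ xs′ , prep y q , refl ∷ (x ∷ʳ s′)
⊆-↭⇒↭-⊆ (refl ∷ (_ ∷ʳ s)) (swap x y p) with ⊆-↭⇒↭-⊆ s p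
... | xs′ , q , s′ = x ∷ xs′ , prep x q , y ∷ʳ (refl ∷ s′)
⊆-↭⇒↭-⊆ (refl ∷ (refl ∷ s)) (swap x y p) with ⊆-↭⇒↭-⊆ s p
... | xs′ , q , s′ = y ∷ x ∷ xs′ , swap x y q , refl ∷ (refl ∷ s′)
⊆-↭⇒↭-⊆ s (trans p₁ p₂) with ⊆-↭⇒↭-⊆ s p₁
... | xs₁ , q₁ , s₁ with ⊆-↭⇒↭-⊆ s₁ p₂
... | xs₂ , q₂ , s₂ = xs₂ , ↭-trans q₁ q₂ , s₂

∈⇒≤maxℕ : ∀ {x xs} → x ∈ xs → x ≤ maxℕ xs
∈⇒≤maxℕ (here refl) = m≤m⊔n _ _
∈⇒≤maxℕ {xs = y ∷ _} (there x∈xs) = ≤-trans (∈⇒≤maxℕ x∈xs) (m≤n⊔m y _)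

foldr-⊓≤ : ∀ x xs → foldr _⊓_ x xs ≤ x
foldr-⊓≤ x [] = ≤-refl
foldr-⊓≤ x (y ∷ ys) = ≤-trans (m⊓n≤n y _) (foldr-⊓≤ x ys)

≤foldr-⊔ : ∀ x xs → x ≤ foldr _⊔_ x xs
≤foldr-⊔ x [] = ≤-refl
≤foldr-⊔ x (y ∷ ys) = ≤-trans (≤foldr-⊔ x ys) (m≤n⊔m y _)

SubsetSum-0 : ∀ Z → SubsetSum Z 0
SubsetSum-0 Z = [] , minimum Z , refl

SubsetSum-++ : ∀ {X Y x y} → SubsetSum X x → SubsetSum Y y → SubsetSum (X ++ Y) (x + y)
SubsetSum-++ (U , U⊆X , refl) (V , V⊆Y , refl) = U ++ V , Sublist.++⁺ U⊆X V⊆Y , sum-++ U V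

SubsetSum-↭ : ∀ {X X′ x} → X ↭ X′ → SubsetSum X x → SubsetSum X′ x
SubsetSum-↭ X↭X′ (Y , Y⊆X , refl) with ⊆-↭⇒↭-⊆ Y⊆X X↭X′
... | Y′ , Y↭Y′ , Y′⊆X′ = Y′ , Y′⊆X′ , sym (sum-↭ Y↭Y′)

sumSubℕ-∁ : ∀ {ℓ} (I : Subset ℓ) (g : Fin ℓ → ℕ) → sumF g ≡ sumSubℕ I g + sumSubℕ (∁ I) g
sumSubℕ-∁ [] g = refl
sumSubℕ-∁ (true ∷ I) g =
  ≡-trans (cong (_+_ (g zero)) (sumSubℕ-∁ I (g ∘ suc))) (sym (+-assoc (g zero) _ _))
sumSubℕ-∁ (false ∷ I) g =
  ≡-trans (cong (_+_ (g zero)) (sumSubℕ-∁ I (g ∘ suc)))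
          (+-left-comm (g zero) (sumSubℕ I (g ∘ suc)) (sumSubℕ (∁ I) (g ∘ suc)))

sumSubℕ-mono : ∀ {ℓ} (I : Subset ℓ) {g h : Fin ℓ → ℕ} → (∀ i → g i ≤ h i) →
               sumSubℕ I g ≤ sumSubℕ I h
sumSubℕ-mono [] g≤h = z≤n
sumSubℕ-mono (true ∷ I) g≤h = +-mono-≤ (g≤h zero) (sumSubℕ-mono I (g≤h ∘ suc))
sumSubℕ-mono (false ∷ I) g≤h = sumSubℕ-mono I (g≤h ∘ suc)

sumSubℕ-⊥ : ∀ {ℓ} (g : Fin ℓ → ℕ) → sumSubℕ ⊥ g ≡ 0
sumSubℕ-⊥ {zero} g = refl
sumSubℕ-⊥ {suc ℓ} g = sumSubℕ-⊥ (g ∘ suc)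

blocks : ∀ {a} {A : Set a} {ℓ} → Subset ℓ → (Fin ℓ → List A) → List A
blocks [] Ds = []
blocks (true ∷ I) Ds = Ds zero ++ blocks I (Ds ∘ suc)
blocks (false ∷ I) Ds = blocks I (Ds ∘ suc)

concat↭blocks++blocks∁ : ∀ {a} {A : Set a} {ℓ} (I : Subset ℓ) (Ds : Fin ℓ → List A) →
                         concat (tabulate Ds) ↭ blocks I Ds ++ blocks (∁ I) Ds
concat↭blocks++blocks∁ [] Ds = refl
concat↭blocks++blocks∁ (true ∷ I) Ds =
  ↭-trans (Perm.++⁺ˡ (Ds zero) (concat↭blocks++blocks∁ I (Ds ∘ suc)))
          (↭-sym (Perm.++-assoc (Ds zero) _ _))
concat↭blocks++blocks∁ (false ∷ I) Ds =
  ↭-trans (Perm.++⁺ˡ (Ds zero) (concat↭blocks++blocks∁ I (Ds ∘ suc)))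
          (Perm.shifts (Ds zero) (blocks I (Ds ∘ suc)))

sum-blocks : ∀ {ℓ} (I : Subset ℓ) (Ds : Fin ℓ → List ℕ) → sum (blocks I Ds) ≡ sumSubℕ I (sum ∘ Ds)
sum-blocks [] Ds = refl
sum-blocks (true ∷ I) Ds =
  ≡-trans (sum-++ (Ds zero) _) (cong (_+_ (sum (Ds zero))) (sum-blocks I (Ds ∘ suc)))
sum-blocks (false ∷ I) Ds = sum-blocks I (Ds ∘ suc)

-- The AP property needs non-empty sets. Padding an empty S_i with 0 ∈ 𝒮(D_i) is harmless, but it
-- makes every diameter at least 1, so the property only applies when u′ ≥ 1.
toℤSet : List ℕ → List ℤ
toℤSet [] = + 0 ∷ []
toℤSet xs@(_ ∷ _) = map +_ xs

toℤSet-≢[] : ∀ xs → toℤSet xs ≢ []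
toℤSet-≢[] [] ()
toℤSet-≢[] (_ ∷ _) ()

toℤSet-unique : ∀ {xs} → Unique xs → Unique (toℤSet xs)
toℤSet-unique {[]} _ = [] ∷ []
toℤSet-unique {_ ∷ _} xs-unique = Unique.map⁺ ℤₚ.+-injective xs-unique

length-toℤSet : ∀ xs → length xs ≤ length (toℤSet xs)
length-toℤSet [] = z≤n
length-toℤSet xs@(_ ∷ _) = ≤-reflexive (sym (List.length-map +_ xs))

diamℤ-map-+ : ∀ x xs → diamℤ (map +_ (x ∷ xs)) ≡ diamℕ (x ∷ xs)
diamℤ-map-+ x xs = cong (_+ 1) (begin
  ∣ foldr ℤ._⊔_ (+ x) (map +_ xs) ℤ.- foldr ℤ._⊓_ (+ x) (map +_ xs) ∣
    ≡⟨ cong₂ (λ M m → ∣ M ℤ.- m ∣) (foldr-map-homo +_ (λ _ _ → refl) x xs)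
                                  (foldr-map-homo +_ (λ _ _ → refl) x xs) ⟩
  ∣ + M ℤ.- + m ∣  ≡⟨ cong ∣_∣ (ℤₚ.m-n≡m⊖n M m) ⟩
  ∣ M ⊖ m ∣        ≡⟨ cong ∣_∣ (ℤₚ.⊖-≥ (≤-trans (foldr-⊓≤ x xs) (≤foldr-⊔ x xs))) ⟩
  M ∸ m            ∎)
  where
  open ≡-Reasoning
  M m : ℕ
  M = foldr _⊔_ x xs
  m = foldr _⊓_ x xs

diam-toℤSet : ∀ xs → diamℤ (toℤSet xs) ≤ diamℕ xs ⊔ 1
diam-toℤSet [] = ≤-refl
diam-toℤSet (x ∷ xs) = ≤-trans (≤-reflexive (diamℤ-map-+ x xs)) (m≤m⊔n _ 1)

SubsetSum≤ : List ℕ → ℕ → ℤ → Set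
SubsetSum≤ Z F c = ∃ λ n → c ≡ + n × SubsetSum Z n × n ≤ F

SubsetSum≤-0 : ∀ {Z F} → SubsetSum≤ Z F (+ 0)
SubsetSum≤-0 {Z} = 0 , refl , SubsetSum-0 Z , z≤n

SubsetSum≤-+ : ∀ {X Y F G x y} → SubsetSum≤ X F x → SubsetSum≤ Y G y →
               SubsetSum≤ (X ++ Y) (F + G) (x ℤ.+ y)
SubsetSum≤-+ (m , refl , sm , m≤F) (n , refl , sn , n≤G) =
  m + n , refl , SubsetSum-++ sm sn , +-mono-≤ m≤F n≤G

toℤSet-SubsetSum≤ : ∀ {Z F} xs → All (SubsetSum Z) xs → maxℕ xs ≤ F →
                    All (SubsetSum≤ Z F) (toℤSet xs)
toℤSet-SubsetSum≤ [] _ _ = SubsetSum≤-0 ∷ []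
toℤSet-SubsetSum≤ xs@(_ ∷ _) sums max≤F = All.map⁺ (All.tabulate λ {x} x∈xs →
  x , refl , All.lookup sums x∈xs , ≤-trans (∈⇒≤maxℕ x∈xs) max≤F)

sumSubℤ-SubsetSum≤ : ∀ {ℓ} (I : Subset ℓ) (Ds : Fin ℓ → List ℕ) (f : Fin ℓ → ℕ) (c : Fin ℓ → ℤ) →
                     (∀ i → i ∈ₛ I → SubsetSum≤ (Ds i) (f i) (c i)) →
                     SubsetSum≤ (blocks I Ds) (sumSubℕ I f) (sumSubℤ I c)
sumSubℤ-SubsetSum≤ [] Ds f c _ = SubsetSum≤-0
sumSubℤ-SubsetSum≤ (true ∷ I) Ds f c c∈ = SubsetSum≤-+ (c∈ zero here)
  (sumSubℤ-SubsetSum≤ I (Ds ∘ suc) (f ∘ suc) (c ∘ suc) (λ i → c∈ (suc i) ∘ there))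
sumSubℤ-SubsetSum≤ (false ∷ I) Ds f c c∈ = SubsetSum≤-+ SubsetSum≤-0
  (sumSubℤ-SubsetSum≤ I (Ds ∘ suc) (f ∘ suc) (c ∘ suc) (λ i → c∈ (suc i) ∘ there))

InSumset⇒SubsetSum≤ : ∀ {ℓ} {A : Fin ℓ → List ℤ} {I x} (Ds : Fin ℓ → List ℕ) (f : Fin ℓ → ℕ) →
                      (∀ i → All (SubsetSum≤ (Ds i) (f i)) (A i)) → InSumset A I x →
                      SubsetSum≤ (blocks I Ds) (sumSubℕ I f) x
InSumset⇒SubsetSum≤ {I = I} Ds f A⊆ (c , c∈A , refl) =
  sumSubℤ-SubsetSum≤ I Ds f c (λ i i∈I → All.lookup (A⊆ i) (c∈A i i∈I))

ℤ-progression⇒ℕ : ∀ {P : ℕ → Set} (a : ℤ) d k → 1 ≤ k →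
                  (∀ j → j < k → ∃ λ n → a ℤ.+ + (j * d) ≡ + n × P n) →
                  ∃ λ m → ∀ j → j < k → P (m + j * d)
ℤ-progression⇒ℕ {P} a d k k≥1 terms = m , term
  where
  m : ℕ
  m = proj₁ (terms 0 k≥1)
  a≡m : a ≡ + m
  a≡m = ≡-trans (sym (ℤₚ.+-identityʳ a)) (proj₁ (proj₂ (terms 0 k≥1)))
  term : ∀ j → j < k → P (m + j * d)
  term j j<k with terms j j<k
  ... | n , a+jd≡n , Pn =
    subst P (sym (ℤₚ.+-injective (≡-trans (cong (λ b → b ℤ.+ + (j * d)) (sym a≡m)) a+jd≡n))) Pn

sumF-mono : ∀ {ℓ} {g h : Fin ℓ → ℕ} → (∀ i → g i ≤ h i) → sumF g ≤ sumF h
sumF-mono {zero} g≤h = z≤n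
sumF-mono {suc ℓ} g≤h = +-mono-≤ (g≤h zero) (sumF-mono (g≤h ∘ suc))

≤maxF : ∀ {ℓ} (g : Fin ℓ → ℕ) i → g i ≤ maxF g
≤maxF g zero = m≤m⊔n _ _
≤maxF g (suc i) = ≤-trans (≤maxF (g ∘ suc) i) (m≤n⊔m (g zero) _)

ρx≤F∧2F≤ρt⇒2x≤t : ∀ ρ .{{_ : NonZero ρ}} {x F t} → ρ * x ≤ F → 2 * F ≤ ρ * t → 2 * x ≤ t
ρx≤F∧2F≤ρt⇒2x≤t ρ {x} {F} {t} ρx≤F 2F≤ρt = *-cancelˡ-≤ ρ (begin
  ρ * (2 * x)  ≡⟨ *-left-comm ρ 2 x ⟩
  2 * (ρ * x)  ≤⟨ *-monoʳ-≤ 2 ρx≤F ⟩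
  2 * F        ≤⟨ 2F≤ρt ⟩
  ρ * t        ∎)
  where open ≤-Reasoning

3t≤2[x+y]∧2x≤t⇒t≤y : ∀ {t x y} → 3 * t ≤ 2 * (x + y) → 2 * x ≤ t → t ≤ y
3t≤2[x+y]∧2x≤t⇒t≤y {t} {x} {y} 3t≤2[x+y] 2x≤t = *-cancelˡ-≤ 2 (+-cancelˡ-≤ t _ _ (begin
  3 * t          ≤⟨ 3t≤2[x+y] ⟩
  2 * (x + y)    ≡⟨ *-distribˡ-+ 2 x y ⟩
  2 * x + 2 * y  ≤⟨ +-monoˡ-≤ (2 * y) 2x≤t ⟩
  t + 2 * y      ∎))
  where open ≤-Reasoning

n²≤2⇒n≤1 : ∀ n → n ^ 2 ≤ 2 → n ≤ 1
n²≤2⇒n≤1 n n²≤2 with n ≤? 1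
... | yes n≤1 = n≤1
... | no n≰1 = contradiction (≤-trans (^-monoˡ-≤ 2 (≰⇒> n≰1)) n²≤2) λ { (s≤s (s≤s ())) }

XLogBound-mono : ∀ {m p q s s′ ℓ} → s ≤ s′ → XLogBound m p q s ℓ → XLogBound m p q s′ ℓ
XLogBound-mono {m} {p} {q} s≤s′ bound =
  ≤-trans bound (*-monoˡ-≤ (q ^ (m * p)) (^-monoʳ-≤ 2 (*-monoʳ-≤ q s≤s′)))

KBound-mono : ∀ {w t p q p′ q′} .{{_ : NonZero q′}} → p * q′ ≤ p′ * q →
              KBound w t p q → KBound w t p′ q′
KBound-mono {w} {t} {p} {q} {p′} {q′} pq′≤p′q bound a b b≥1 p′b≤q′a =
  bound a b b≥1 (*-cancelʳ-≤ _ _ (q′ * q′) {{m*n≢0 q′ q′}} (begin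
    p * p * (b * b) * (q′ * q′)                 ≡⟨ regroup p q′ b ⟩
    p * q′ * (p * q′) * (b * b)                 ≤⟨ *-monoˡ-≤ (b * b) (*-mono-≤ pq′≤p′q pq′≤p′q) ⟩
    p′ * q * (p′ * q) * (b * b)                 ≡⟨ sym (regroup p′ q b) ⟩
    p′ * p′ * (b * b) * (q * q)                 ≤⟨ *-monoˡ-≤ (q * q) p′b≤q′a ⟩
    25 * w * t * (q′ * q′) * (a * a) * (q * q)  ≡⟨ swap-squares (25 * w * t) q′ a q ⟩
    25 * w * t * (q * q) * (a * a) * (q′ * q′)  ∎))
  where
  open ≤-Reasoning
  regroup : ∀ x y z → x * x * (z * z) * (y * y) ≡ x * y * (x * y) * (z * z)
  regroup = solve-∀
  swap-squares : ∀ c x y z → c * (x * x) * (y * y) * (z * z) ≡ c * (z * z) * (y * y) * (x * x)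
  swap-squares = solve-∀

w≤1⇒KBound : ∀ {w t} p q → w ≤ 1 → KBound w t p q
w≤1⇒KBound p q w≤1 a b _ _ = ≤-trans (≤-trans (^-monoˡ-≤ b w≤1) (≤-reflexive (^-zeroˡ b))) (m^n>0 2 a)

-- Evaluate the bound at a/b = 1/2: since (p/q)² < 1 ≤ 25wt/4, it yields w² ≤ 2.
KBound-<1⇒w≤1 : ∀ {w t p q} → 1 ≤ t → p < q → KBound w t p q → w ≤ 1
KBound-<1⇒w≤1 {zero} _ _ _ = z≤n
KBound-<1⇒w≤1 {suc w} {t} {p} {q} t≥1 p<q bound = n²≤2⇒n≤1 (suc w) (bound 1 2 (s≤s z≤n) (begin
  p * p * (2 * 2)                     ≤⟨ *-monoˡ-≤ 4 (*-mono-≤ (<⇒≤ p<q) (<⇒≤ p<q)) ⟩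
  q * q * 4                           ≤⟨ *-monoʳ-≤ (q * q) 4≤25wt ⟩
  q * q * (25 * suc w * t)            ≡⟨ *-comm (q * q) _ ⟩
  25 * suc w * t * (q * q)            ≡⟨ sym (*-identityʳ _) ⟩
  25 * suc w * t * (q * q) * (1 * 1)  ∎))
  where
  open ≤-Reasoning
  4≤25wt : 4 ≤ 25 * suc w * t
  4≤25wt = ≤-trans (m≤m+n 4 21) (*-mono-≤ (*-monoʳ-≤ 25 (s≤s {n = w} z≤n)) t≥1)

APProperty-toℤSet : ∀ C {ℓ} → APProperty C → (S : Fin ℓ → List ℕ) (f : Fin ℓ → ℕ) {p q ρ : ℕ} →
  (∀ i → Unique (S i)) → 1 ≤ p → 1 ≤ q → q ≤ p → maxF (diamℕ ∘ S) * q ≤ p → 1 ≤ ρ →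
  XLogBound (4 * C * ρ) p q (sumF (length ∘ S)) ℓ →
  Σ (Subset ℓ) λ I → Σ ℤ λ a → Σ ℕ λ d → Σ ℕ λ k →
    (1 ≤ d) × (p ≤ k * q) ×
    (∀ j → j < k → InSumset (toℤSet ∘ S) I (a ℤ.+ + (j * d))) ×
    (ρ * sumSubℕ I f ≤ sumF f)
APProperty-toℤSet C {ℓ} ap S f {p} {q} {ρ} S-unique p≥1 q≥1 q≤p diam≤ ρ≥1 bound =
  ap ℓ (toℤSet ∘ S) f (maxF (diamℕ ∘ S) ⊔ 1) p q ρ (toℤSet-≢[] ∘ S) (toℤSet-unique ∘ S-unique)
     (λ i → ≤-trans (diam-toℤSet (S i)) (⊔-monoˡ-≤ 1 (≤maxF (diamℕ ∘ S) i)))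
     p≥1 q≥1 uq≤p ρ≥1
     (XLogBound-mono {4 * C * ρ} {p} {q} {ℓ = ℓ} (sumF-mono (length-toℤSet ∘ S)) bound)
  where
  open ≤-Reasoning
  uq≤p : (maxF (diamℕ ∘ S) ⊔ 1) * q ≤ p
  uq≤p = begin
    (maxF (diamℕ ∘ S) ⊔ 1) * q    ≡⟨ *-distribʳ-⊔ q (maxF (diamℕ ∘ S)) 1 ⟩
    maxF (diamℕ ∘ S) * q ⊔ 1 * q  ≡⟨ cong (maxF (diamℕ ∘ S) * q ⊔_) (*-identityˡ q) ⟩
    maxF (diamℕ ∘ S) * q ⊔ q      ≤⟨ ⊔-lub diam≤ q≤p ⟩
    p                             ∎

LongProgressionWithSlack : ℕ → ℕ → List ℕ → Set
LongProgressionWithSlack w t D =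
  Σ (List ℕ) λ P → (P ⊆ D) ×
    Σ ℕ λ a → Σ ℕ λ d → Σ ℕ λ k →
      (1 ≤ d) × (1 ≤ k) ×
      (∀ j → j < k → SubsetSum P (a + j * d)) ×
      KBound w t k 1 ×
      (2 * (a + (k ∸ 1) * d) ≤ t) ×
      (sum P + t ≤ sum D)

module _ {t ℓ : ℕ} {D : List ℕ} {Ds : Fin ℓ → List ℕ} (Ds↭D : concat (tabulate Ds) ↭ D)
         {f : Fin ℓ → ℕ} (f≤σDs : ∀ i → f i ≤ sum (Ds i)) (3t≤2F : 3 * t ≤ 2 * sumF f) where

  blocks-slack : ∀ I → 2 * sumSubℕ I f ≤ t → sum (blocks I Ds) + t ≤ sum D
  blocks-slack I 2ΣI≤t = begin
    sum (blocks I Ds) + t                      ≤⟨ +-monoʳ-≤ (sum (blocks I Ds)) t≤σ∁I ⟩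
    sum (blocks I Ds) + sum (blocks (∁ I) Ds)  ≡⟨ sym (sum-++ (blocks I Ds) _) ⟩
    sum (blocks I Ds ++ blocks (∁ I) Ds)       ≡⟨ sym (sum-↭ (concat↭blocks++blocks∁ I Ds)) ⟩
    sum (concat (tabulate Ds))                 ≡⟨ sum-↭ Ds↭D ⟩
    sum D                                      ∎
    where
    open ≤-Reasoning
    3t≤2[ΣI+Σ∁I] : 3 * t ≤ 2 * (sumSubℕ I f + sumSubℕ (∁ I) f)
    3t≤2[ΣI+Σ∁I] = subst (λ F → 3 * t ≤ 2 * F) (sumSubℕ-∁ I f) 3t≤2F
    t≤σ∁I : t ≤ sum (blocks (∁ I) Ds)
    t≤σ∁I = begin
      t                          ≤⟨ 3t≤2[x+y]∧2x≤t⇒t≤y {x = sumSubℕ I f} 3t≤2[ΣI+Σ∁I] 2ΣI≤t ⟩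
      sumSubℕ (∁ I) f            ≤⟨ sumSubℕ-mono (∁ I) f≤σDs ⟩
      sumSubℕ (∁ I) (sum ∘ Ds)   ≡⟨ sym (sum-blocks (∁ I) Ds) ⟩
      sum (blocks (∁ I) Ds)      ∎

  progression-in-blocks⇒LongProgressionWithSlack :
    ∀ {w} I → 2 * sumSubℕ I f ≤ t → ∀ m d k → 1 ≤ d → 1 ≤ k → KBound w t k 1 →
    (∀ j → j < k → SubsetSum (blocks I Ds) (m + j * d) × m + j * d ≤ sumSubℕ I f) →
    LongProgressionWithSlack w t D
  progression-in-blocks⇒LongProgressionWithSlack I 2ΣI≤t m d k d≥1 k≥1 long terms
    with ⊆-↭⇒↭-⊆ (Sublist.++⁺ʳ (blocks (∁ I) Ds) ⊆-refl)
                 (↭-trans (↭-sym (concat↭blocks++blocks∁ I Ds)) Ds↭D)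
  ... | P , blocks↭P , P⊆D =
    P , P⊆D , m , d , k , d≥1 , k≥1 ,
    (λ j j<k → SubsetSum-↭ blocks↭P (proj₁ (terms j j<k))) , long ,
    ≤-trans (*-monoʳ-≤ 2 (proj₂ (terms (k ∸ 1) (∸-monoʳ-< (s≤s z≤n) k≥1)))) 2ΣI≤t ,
    subst (λ s → s + t ≤ sum D) (sum-↭ blocks↭P) (blocks-slack I 2ΣI≤t)

  w≤1⇒LongProgressionWithSlack : ∀ {w} → w ≤ 1 → LongProgressionWithSlack w t D
  w≤1⇒LongProgressionWithSlack w≤1 =
    progression-in-blocks⇒LongProgressionWithSlack ⊥ 2Σ⊥≤t 0 1 1 ≤-refl ≤-refl
      (w≤1⇒KBound 1 1 w≤1) λ { zero _ → SubsetSum-0 _ , z≤n ; (suc _) (s≤s ()) }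
    where
    2Σ⊥≤t : 2 * sumSubℕ ⊥ f ≤ t
    2Σ⊥≤t = subst (λ s → 2 * s ≤ t) (sym (sumSubℕ-⊥ f)) z≤n

lemma7 : (C : ℕ) → APProperty C →
         (w t : ℕ) → 1 ≤ w → 1 ≤ t →
         (D : List ℕ) → All (λ x → (1 ≤ x) × (x ≤ w)) D →
         Dense C w t D →
         Σ (List ℕ) λ P → (P ⊆ D) ×
           Σ ℕ λ a → Σ ℕ λ d → Σ ℕ λ k →
             (1 ≤ d) × (1 ≤ k) ×
             (∀ j → j < k → SubsetSum P (a + j * d)) ×
             KBound w t k 1 ×
             (2 * (a + (k ∸ 1) * d) ≤ t) ×
             (sum P + t ≤ sum D)
lemma7 C ap w t _ t≥1 D _
  (ℓ , ρ , ρ≥1 , Ds , _ , Ds↭D , S , S-unique , S⊆𝒮Ds , f , f-bounds , 3t≤2F , 2F≤ρt ,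
   p , q , p≥1 , q≥1 , diam≤ , long , bound)
  with q ≤? p
... | no q≰p = w≤1⇒LongProgressionWithSlack Ds↭D (proj₂ ∘ f-bounds) 3t≤2F
                 (KBound-<1⇒w≤1 {w} {t} {p} {q} t≥1 (≰⇒> q≰p) long)
... | yes q≤p with APProperty-toℤSet C ap S f S-unique p≥1 q≥1 q≤p diam≤ ρ≥1 bound
... | I , a , d , k , d≥1 , p≤kq , AP , ρΣI≤F =
  progression-in-blocks⇒LongProgressionWithSlack Ds↭D (proj₂ ∘ f-bounds) 3t≤2F I
    (ρx≤F∧2F≤ρt⇒2x≤t ρ {{>-nonZero ρ≥1}} ρΣI≤F 2F≤ρt) (proj₁ progression) d k d≥1 k≥1
    (KBound-mono {w} {t} {p} {q} {k} {1} (≤-trans (≤-reflexive (*-identityʳ p)) p≤kq) long)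
    (proj₂ progression)
  where
  k≥1 : 1 ≤ k
  k≥1 = >-nonZero⁻¹ k {{m*n≢0⇒m≢0 k {{>-nonZero (≤-trans p≥1 p≤kq)}}}}
  S-in-range : ∀ i → All (SubsetSum≤ (Ds i) (f i)) (toℤSet (S i))
  S-in-range i = toℤSet-SubsetSum≤ (S i) (S⊆𝒮Ds i) (proj₁ (f-bounds i))
  progression : ∃ λ m → ∀ j → j < k →
                SubsetSum (blocks I Ds) (m + j * d) × m + j * d ≤ sumSubℕ I f
  progression =
    ℤ-progression⇒ℕ a d k k≥1 (λ j j<k → InSumset⇒SubsetSum≤ Ds f S-in-range (AP j j<k))
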